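{- For a matroid $M$, the following statements are equivalent: (1) there are proper flats $F_1$ and $F_2$ of $M$ with $|E(M)-(F_1\cup F_2)|\leq 1$; (2) $\kappa(M^t)<r(M^t)$ for all integers $t\geq 2$; (3) $\kappa(M^t)<r(M^t)$ for some integer $t\geq 2$. Consequently, if $E(M)$ is not the union of two proper flats of $M$ and a singleton subset of $E(M)$, then $\kappa(M^t)=r(M^t)$ for all $t\in\mathbb{N}$.
   Context: A cyclic flat of a matroid $M$ is a flat $F$ such that $M|F$ has no coloops; $\mathcal{Z}(M)$ denotes the set of cyclic flats, and a matroid is determined by its cyclic flats and their ranks. The $t$-expansion: fix $t\in\mathbb{N}$; for each $e\in E(M)$ let $S_e$ be a $t$-element set with $e\in S_e$, the sets $S_e$ pairwise disjoint; for $X\subseteq E(M)$ let $S_X=\bigcup_{e\in X}S_e$. The $t$-expansion $M^t$ is the matroid on $S_{E(M)}$ whose cyclic flats are exactly the sets $S_A$ with $A\in\mathcal{Z}(M)$, with $r_{M^t}(S_A)=t\cdot r_M(A)$. For $X\subseteq E(M)$ let $\overline{X}=E(M)-X$ and $\lambda_M(X)=r(X)+r(\overline{X})-r(M)$. A vertical $k$-separation is a pair $(X,\overline{X})$ with $r(X)\geq k$, $r(\overline{X})\geq k$ and $\lambda_M(X)<k$. The vertical connectivity $\kappa(M)$ is the least $k$ such that $M$ has a vertical $k$-separation if one exists, and $\kappa(M)=r(M)$ otherwise; in particular $\kappa(M)<r(M)$ if and only if $E(M)$ is a union of two proper flats of $M$. -}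

module Defs where

open import Data.Nat using (ℕ; zero; suc; _+_; _*_; _∸_; _≤_; _<_; _≥_; _≤?_; _<?_)
open import Data.Bool using (Bool; true; false; if_then_else_)
open import Data.Fin using (Fin; remQuot)
open import Data.Fin.Subset using (Subset; _∈_; _∉_; _⊆_; _∪_; _∩_; ∁; ⁅_⁆; ⊤; ∣_∣; _─_)
open import Data.Fin.Subset.Properties using (anySubset?)
open import Data.Vec using (tabulate; lookup)
open import Data.Product using (Σ; ∃; _×_; _,_; proj₁)
open import Relation.Nullary using (¬_; Dec; does)
open import Relation.Nullary.Decidable using (_×-dec_)
open import Relation.Binary.PropositionalEquality using (_≡_)

record Matroid (n : ℕ) : Set where
  field
    r        : Subset n → ℕ
    r-bound  : ∀ X → r X ≤ ∣ X ∣
    r-mono   : ∀ {X Y} → X ⊆ Y → r X ≤ r Y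
    r-submod : ∀ X Y → r (X ∪ Y) + r (X ∩ Y) ≤ r X + r Y

open Matroid public

module _ {n : ℕ} (M : Matroid n) where

  rankM : ℕ
  rankM = r M ⊤

  IsFlat : Subset n → Set
  IsFlat F = ∀ e → e ∉ F → r M F < r M (F ∪ ⁅ e ⁆)

  IsProperFlat : Subset n → Set
  IsProperFlat F = IsFlat F × ¬ (F ≡ ⊤)

  IsColoopOfRestriction : Subset n → Fin n → Set
  IsColoopOfRestriction F e = e ∈ F × r M (F ─ ⁅ e ⁆) < r M F

  IsCyclicFlat : Subset n → Set
  IsCyclicFlat F = IsFlat F × (∀ e → ¬ IsColoopOfRestriction F e)

  conn : Subset n → ℕ
  conn X = (r M X + r M (∁ X)) ∸ rankM

  IsVertSep : ℕ → Subset n → Set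
  IsVertSep k X = (r M X ≥ k) × (r M (∁ X) ≥ k) × (conn X < k)

  HasVertSep : ℕ → Set
  HasVertSep k = ∃ λ X → IsVertSep k X

  hasVertSep? : ∀ k → Dec (HasVertSep k)
  hasVertSep? k = anySubset? (λ X → (k ≤? r M X) ×-dec ((k ≤? r M (∁ X)) ×-dec (conn X <? k)))

  private
    search : ℕ → ℕ → ℕ → ℕ
    search i zero    d = d
    search i (suc m) d = if does (hasVertSep? i) then i else search (suc i) m d

  -- vertical connectivity κ(M): the least k such that M has a vertical
  -- k-separation, and r(M) if there is none.  (Any vertical k-separation
  -- has k ≤ r(X) ≤ r(M), so searching k = 0 .. r(M) is exhaustive.)
  κ : ℕ
  κ = search 0 (suc rankM) rankM

-- t-expansion.  S_e is modelled as {e} × Fin t, and E(M) × Fin t is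
-- identified with Fin (n * t) via Data.Fin.remQuot / combine.
-- S_X = ⋃_{e ∈ X} S_e.
S[_] : ∀ {n} t → Subset n → Subset (n * t)
S[_] {n} t X = tabulate (λ i → lookup X (proj₁ (remQuot {n} t i)))

-- N is the t-expansion M^t of M: its cyclic flats are exactly the sets S_A
-- with A a cyclic flat of M, and r_N(S_A) = t · r_M(A).
IsExpansion : ∀ {n} (t : ℕ) → Matroid n → Matroid (n * t) → Set
IsExpansion t M N =
  (∀ Y → IsCyclicFlat N Y → ∃ λ A → IsCyclicFlat M A × Y ≡ S[ t ] A)
  × (∀ A → IsCyclicFlat M A → IsCyclicFlat N (S[ t ] A))
  × (∀ A → IsCyclicFlat M A → r N (S[ t ] A) ≡ t * r M A)

-- For an expansion N of M the rank function is forced: every set is spanned, up to a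
-- free remainder, by a cyclic flat, and the cyclic flats of N are the sets S_A, so
-- r_N(Y) = min_A (t·r_M(A) + |Y − S_A|).  Now κ(N) < r(N) iff some Y and E − Y are both
-- nonspanning in N.  Given such Y, take minimising A₁ and A₂: the fibres of the elements
-- outside A₁ ∪ A₂ are counted on the two sides, which leaves enough room to distribute all
-- but one of those elements over two proper flats of M.  Conversely, proper flats F₁, F₂
-- missing at most one element d give the split S_{F₁} ∪ (S_d − j) against its complement,
-- nonspanning on both sides once t ≥ 2.  Taken as a definition, the minimum formula
-- satisfies the rank axioms and has exactly the S_A with A cyclic as cyclic flats, so the
-- expansion exists.
module Submission where

open import Defs
open import Data.Bool using (Bool; true; false; if_then_else_; not)
open import Data.Empty using (⊥-elim)
open import Data.Fin using (Fin; zero; suc; quotient; combine; fromℕ<; _↑ˡ_; _↑ʳ_)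
open import Data.Fin.Properties using (any?; remQuot-combine; splitAt-↑ˡ; splitAt-↑ʳ) renaming (_≟_ to _≟ᶠ_)
open import Data.Fin.Subset using (Subset; _∈_; _∉_; _⊆_; _⊂_; _∪_; _∩_; _─_; _-_; ∁; ⁅_⁆; ⊤; ⊥; ∣_∣)
open import Data.Fin.Subset.Properties
open import Data.Nat using (ℕ; zero; suc; _+_; _*_; _∸_; _⊓_; _≤_; _<_; _≥_; z≤n; z<s; s≤s; s≤s⁻¹; _≤?_; _<?_)
open import Data.Nat.Properties
open import Data.Nat.Solver using (module +-*-Solver)
open import Data.Product as Product using (∃; ∃₂; _×_; _,_; proj₁; proj₂)
open import Data.Sum using (_⊎_; inj₁; inj₂; [_,_]′)
open import Data.Vec using (_∷_; []; here; there; tabulate; lookup; zipWith)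
open import Data.Vec.Properties
  using (lookup∘tabulate; tabulate∘lookup; tabulate-cong; tabulate-∘; lookup-zipWith; lookup-map; []=⇒lookup; lookup⇒[]=)
open import Function using (_∘_; id)
open import Relation.Nullary using (¬_; yes; no; does)
open import Relation.Nullary.Decidable using (decidable-stable; ¬?; _×-dec_)
open import Relation.Binary.PropositionalEquality
open import Induction.WellFounded using (module All)
import Relation.Binary.Construct.On as On
open import Data.Nat.Induction using (<-wellFounded)
open import Algebra.Properties.CommutativeSemigroup +-commutativeSemigroup using (interchange)

open +-*-Solver

x∈p─q⁻ : ∀ {n} {x : Fin n} (p q : Subset n) → x ∈ p ─ q → x ∈ p × x ∉ q
x∈p─q⁻ {x = zero} (true ∷ p) (false ∷ q) here = here , λ ()
x∈p─q⁻ {x = suc x} (_ ∷ p) (_ ∷ q) (there x∈p─q) =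
  Product.map there (_∘ drop-there) (x∈p─q⁻ p q x∈p─q)

p⊆[p─q]∪q : ∀ {n} (p q : Subset n) → p ⊆ (p ─ q) ∪ q
p⊆[p─q]∪q p q {x} x∈p with x ∈? q
... | yes x∈q = x∈p∪q⁺ (inj₂ x∈q)
... | no x∉q = x∈p∪q⁺ (inj₁ (x∈p∧x∉q⇒x∈p─q x∈p x∉q))

p─r⊆[p─q]∪[q─r] : ∀ {n} (p q r : Subset n) → p ─ r ⊆ (p ─ q) ∪ (q ─ r)
p─r⊆[p─q]∪[q─r] p q r {x} x∈p─r with x∈p─q⁻ p r x∈p─r | x ∈? q
... | x∈p , x∉r | yes x∈q = x∈p∪q⁺ (inj₂ (x∈p∧x∉q⇒x∈p─q x∈q x∉r))
... | x∈p , x∉r | no x∉q = x∈p∪q⁺ (inj₁ (x∈p∧x∉q⇒x∈p─q x∈p x∉q))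

p─r⊆q─r : ∀ {n} {p q : Subset n} r → p ⊆ q → p ─ r ⊆ q ─ r
p─r⊆q─r {p = p} r p⊆q x∈ = let x∈p , x∉r = x∈p─q⁻ p r x∈ in x∈p∧x∉q⇒x∈p─q (p⊆q x∈p) x∉r

∣p∪q∣+∣p∩q∣≡∣p∣+∣q∣ : ∀ {n} (p q : Subset n) → ∣ p ∪ q ∣ + ∣ p ∩ q ∣ ≡ ∣ p ∣ + ∣ q ∣
∣p∪q∣+∣p∩q∣≡∣p∣+∣q∣ [] [] = refl
∣p∪q∣+∣p∩q∣≡∣p∣+∣q∣ (true ∷ p) (true ∷ q) =
  cong suc (trans (+-suc _ _) (trans (cong suc (∣p∪q∣+∣p∩q∣≡∣p∣+∣q∣ p q)) (sym (+-suc _ _))))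
∣p∪q∣+∣p∩q∣≡∣p∣+∣q∣ (true ∷ p) (false ∷ q) = cong suc (∣p∪q∣+∣p∩q∣≡∣p∣+∣q∣ p q)
∣p∪q∣+∣p∩q∣≡∣p∣+∣q∣ (false ∷ p) (true ∷ q) =
  trans (cong suc (∣p∪q∣+∣p∩q∣≡∣p∣+∣q∣ p q)) (sym (+-suc _ _))
∣p∪q∣+∣p∩q∣≡∣p∣+∣q∣ (false ∷ p) (false ∷ q) = ∣p∪q∣+∣p∩q∣≡∣p∣+∣q∣ p q

∣p∪q∣≤∣p∣+∣q∣ : ∀ {n} (p q : Subset n) → ∣ p ∪ q ∣ ≤ ∣ p ∣ + ∣ q ∣
∣p∪q∣≤∣p∣+∣q∣ p q = subst (∣ p ∪ q ∣ ≤_) (∣p∪q∣+∣p∩q∣≡∣p∣+∣q∣ p q) (m≤m+n _ _)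

∣p∪⁅x⁆∣≤1+∣p∣ : ∀ {n} (p : Subset n) x → ∣ p ∪ ⁅ x ⁆ ∣ ≤ suc ∣ p ∣
∣p∪⁅x⁆∣≤1+∣p∣ p x = begin
  ∣ p ∪ ⁅ x ⁆ ∣     ≤⟨ ∣p∪q∣≤∣p∣+∣q∣ p ⁅ x ⁆ ⟩
  ∣ p ∣ + ∣ ⁅ x ⁆ ∣ ≡⟨ cong (∣ p ∣ +_) (∣⁅x⁆∣≡1 x) ⟩
  ∣ p ∣ + 1         ≡⟨ +-comm ∣ p ∣ 1 ⟩
  suc ∣ p ∣         ∎
  where open ≤-Reasoning

∣p∣+∣q∣≤∣r∣+∣s∣ : ∀ {n} {p q r s : Subset n} → p ∪ q ⊆ r ∪ s → p ∩ q ⊆ r ∩ s →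
                  ∣ p ∣ + ∣ q ∣ ≤ ∣ r ∣ + ∣ s ∣
∣p∣+∣q∣≤∣r∣+∣s∣ {p = p} {q} {r} {s} ∪⊆ ∩⊆ = begin
  ∣ p ∣ + ∣ q ∣             ≡⟨ ∣p∪q∣+∣p∩q∣≡∣p∣+∣q∣ p q ⟨
  ∣ p ∪ q ∣ + ∣ p ∩ q ∣     ≤⟨ +-mono-≤ (p⊆q⇒∣p∣≤∣q∣ ∪⊆) (p⊆q⇒∣p∣≤∣q∣ ∩⊆) ⟩
  ∣ r ∪ s ∣ + ∣ r ∩ s ∣     ≡⟨ ∣p∪q∣+∣p∩q∣≡∣p∣+∣q∣ r s ⟩
  ∣ r ∣ + ∣ s ∣             ∎
  where open ≤-Reasoning

∣p─q∣≡0 : ∀ {n} {p q : Subset n} → p ⊆ q → ∣ p ─ q ∣ ≡ 0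
∣p─q∣≡0 {n} {p} {q} p⊆q = n≤0⇒n≡0 (begin
  ∣ p ─ q ∣ ≤⟨ p⊆q⇒∣p∣≤∣q∣ {q = ⊥} (λ x∈p─q → let x∈p , x∉q = x∈p─q⁻ p q x∈p─q in ⊥-elim (x∉q (p⊆q x∈p))) ⟩
  ∣ ⊥ {n} ∣ ≡⟨ ∣⊥∣≡0 n ⟩
  0         ∎)
  where open ≤-Reasoning

∣[p-x]─q∣<∣p─q∣ : ∀ {n} {x : Fin n} (p q : Subset n) → x ∈ p ─ q → ∣ (p - x) ─ q ∣ < ∣ p ─ q ∣
∣[p-x]─q∣<∣p─q∣ {x = x} p q x∈p─q =
  subst (_< ∣ p ─ q ∣) (cong ∣_∣ (p─q─r≡p─r─q p q ⁅ x ⁆)) (x∈p⇒∣p-x∣<∣p∣ x∈p─q)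

∃∉-of-≢⊤ : ∀ {n} {p : Subset n} → p ≢ ⊤ → ∃ λ x → x ∉ p
∃∉-of-≢⊤ {p = p} p≢⊤ with any? (λ x → ¬? (x ∈? p))
... | yes x∉p = x∉p
... | no ¬x∉p = ⊥-elim (p≢⊤ (⊆-antisym ⊆⊤ λ {x} _ → decidable-stable (x ∈? p) (λ x∉p → ¬x∉p (x , x∉p))))

⊆⁅⁆-of-∣∣≤1 : ∀ {n} (p : Subset n) → ∣ p ∣ ≤ 1 → Fin n → ∃ λ x → p ⊆ ⁅ x ⁆
⊆⁅⁆-of-∣∣≤1 p ∣p∣≤1 default with nonempty? p
... | no empty = default , λ {y} y∈p → ⊥-elim (empty (y , y∈p))
... | yes (x , x∈p) = x , λ {y} y∈p → subst (_∈ ⁅ x ⁆) (sym (y≡x y∈p)) (x∈⁅x⁆ x)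
  where
  y≡x : ∀ {y} → y ∈ p → y ≡ x
  y≡x {y} y∈p = decidable-stable (y ≟ᶠ x) λ y≢x → <⇒≱ (begin-strict
    1           ≡⟨ ∣⁅x⁆∣≡1 y ⟨
    ∣ ⁅ y ⁆ ∣   ≤⟨ p⊆q⇒∣p∣≤∣q∣ (λ z∈⁅y⁆ → subst (_∈ p - x) (sym (x∈⁅y⁆⇒x≡y y z∈⁅y⁆)) (x∈p∧x≢y⇒x∈p-y y∈p y≢x)) ⟩
    ∣ p - x ∣   <⟨ x∈p⇒∣p-x∣<∣p∣ x∈p ⟩
    ∣ p ∣       ∎) ∣p∣≤1
    where open ≤-Reasoning

splitOff : ∀ {n} (W : Subset n) a b → ∣ W ∣ ≤ a + b → ∃ λ B → ∣ B ∣ ≤ a × ∣ W ─ B ∣ ≤ b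
splitOff [] a b _ = [] , z≤n , z≤n
splitOff (false ∷ W) a b ∣W∣≤ = Product.map (false ∷_) id (splitOff W a b ∣W∣≤)
splitOff {suc n} (true ∷ W) zero b ∣W∣≤ =
  ⊥ , ≤-reflexive (∣⊥∣≡0 (suc n)) , subst (λ V → ∣ V ∣ ≤ b) (sym (p─⊥≡p (true ∷ W))) ∣W∣≤
splitOff (true ∷ W) (suc a) b (s≤s ∣W∣≤) =
  Product.map (true ∷_) (Product.map s≤s id) (splitOff W a b ∣W∣≤)

∁[p∪q]⊆[r─p]∪[∁r─q] : ∀ {n} (p q r : Subset n) → ∁ (p ∪ q) ⊆ (r ─ p) ∪ (∁ r ─ q)
∁[p∪q]⊆[r─p]∪[∁r─q] p q r {x} x∈ with x ∈? r
... | yes x∈r = p⊆p∪q _ (x∈p∧x∉q⇒x∈p─q x∈r (x∈∁p⇒x∉p x∈ ∘ p⊆p∪q q))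
... | no x∉r = q⊆p∪q (r ─ p) _ (x∈p∧x∉q⇒x∈p─q (x∉p⇒x∈∁p x∉r) (x∈∁p⇒x∉p x∈ ∘ q⊆p∪q p q))

[p∪q]─p⊆q : ∀ {n} (p q : Subset n) → (p ∪ q) ─ p ⊆ q
[p∪q]─p⊆q p q x∈ = let x∈p∪q , x∉p = x∈p─q⁻ (p ∪ q) p x∈ in [ ⊥-elim ∘ x∉p , id ]′ (x∈p∪q⁻ p q x∈p∪q)

∁[r₁∪r₂]⊆∁[p₁∪p₂]─q₁─q₂ : ∀ {n} {p₁ p₂ q₁ q₂ r₁ r₂ : Subset n} → p₁ ∪ q₁ ⊆ r₁ → p₂ ∪ q₂ ⊆ r₂ →
                          ∁ (r₁ ∪ r₂) ⊆ ∁ (p₁ ∪ p₂) ─ q₁ ─ q₂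
∁[r₁∪r₂]⊆∁[p₁∪p₂]─q₁─q₂ {p₁ = p₁} {p₂} {q₁} {q₂} {r₁} {r₂} ⊆r₁ ⊆r₂ {x} x∈ =
  x∈p∧x∉q⇒x∈p─q (x∈p∧x∉q⇒x∈p─q (x∉p⇒x∈∁p x∉p₁∪p₂) (x∉r₁ ∘ ⊆r₁ ∘ q⊆p∪q p₁ q₁)) (x∉r₂ ∘ ⊆r₂ ∘ q⊆p∪q p₂ q₂)
  where
  x∉r₁ : x ∉ r₁
  x∉r₁ = x∈∁p⇒x∉p x∈ ∘ p⊆p∪q r₂
  x∉r₂ : x ∉ r₂
  x∉r₂ = x∈∁p⇒x∉p x∈ ∘ q⊆p∪q r₁ r₂
  x∉p₁∪p₂ : x ∉ p₁ ∪ p₂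
  x∉p₁∪p₂ = [ x∉r₁ ∘ ⊆r₁ ∘ p⊆p∪q q₁ , x∉r₂ ∘ ⊆r₂ ∘ p⊆p∪q q₂ ]′ ∘ x∈p∪q⁻ p₁ p₂

∁[p∪[s-x]]─q⊆⁅x⁆ : ∀ {n} {p q s : Subset n} x → ∁ (p ∪ q) ⊆ s → ∁ (p ∪ (s - x)) ─ q ⊆ ⁅ x ⁆
∁[p∪[s-x]]─q⊆⁅x⁆ {p = p} {q} {s} x ∁[p∪q]⊆s {y} y∈ with y ≟ᶠ x
... | yes refl = x∈⁅x⁆ x
... | no y≢x = ⊥-elim (y∉p∪[s-x] (q⊆p∪q p _ (x∈p∧x≢y⇒x∈p-y (∁[p∪q]⊆s (x∉p⇒x∈∁p y∉p∪q)) y≢x)))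
  where
  y∉p∪[s-x] : y ∉ p ∪ (s - x)
  y∉p∪[s-x] = x∈∁p⇒x∉p (proj₁ (x∈p─q⁻ _ q y∈))
  y∉p∪q : y ∉ p ∪ q
  y∉p∪q = [ y∉p∪[s-x] ∘ p⊆p∪q _ , proj₂ (x∈p─q⁻ _ q y∈) ]′ ∘ x∈p∪q⁻ p q

[p∪q]─[p∪⁅x⁆]⊆q-x : ∀ {n} (p q : Subset n) x → (p ∪ q) ─ (p ∪ ⁅ x ⁆) ⊆ q - x
[p∪q]─[p∪⁅x⁆]⊆q-x p q x y∈ with x∈p─q⁻ (p ∪ q) (p ∪ ⁅ x ⁆) y∈
... | y∈p∪q , y∉p∪⁅x⁆ = x∈p∧x∉q⇒x∈p─q
  ([ ⊥-elim ∘ y∉p∪⁅x⁆ ∘ p⊆p∪q ⁅ x ⁆ , id ]′ (x∈p∪q⁻ p q y∈p∪q)) (y∉p∪⁅x⁆ ∘ q⊆p∪q p ⁅ x ⁆)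

p─q⊆p-x : ∀ {n} (p q : Subset n) {x} → x ∈ q → p ─ q ⊆ p - x
p─q⊆p-x p q {x} x∈q y∈ = let y∈p , y∉q = x∈p─q⁻ p q y∈ in
  x∈p∧x∉q⇒x∈p─q y∈p (λ y∈⁅x⁆ → y∉q (subst (_∈ q) (sym (x∈⁅y⁆⇒x≡y x y∈⁅x⁆)) x∈q))

p∪⁅x⁆⊆p∪q : ∀ {n} (p q : Subset n) {x} → x ∈ q → p ∪ ⁅ x ⁆ ⊆ p ∪ q
p∪⁅x⁆⊆p∪q p q {x} x∈q y∈ = [ p⊆p∪q q , (λ y∈⁅x⁆ → q⊆p∪q p q (subst (_∈ q) (sym (x∈⁅y⁆⇒x≡y x y∈⁅x⁆)) x∈q)) ]′
  (x∈p∪q⁻ p ⁅ x ⁆ y∈)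

[p-x]─[p─q]⊆q-x : ∀ {n} (p q : Subset n) x → (p - x) ─ (p ─ q) ⊆ q - x
[p-x]─[p─q]⊆q-x p q x {y} y∈ with x∈p─q⁻ (p - x) (p ─ q) y∈
... | y∈p-x , y∉p─q = let y∈p , y∉⁅x⁆ = x∈p─q⁻ p ⁅ x ⁆ y∈p-x in
  x∈p∧x∉q⇒x∈p─q (decidable-stable (y ∈? q) (y∉p─q ∘ x∈p∧x∉q⇒x∈p─q y∈p)) y∉⁅x⁆

∣[p₁∪p₂]─[q₁∪q₂]∣+∣[p₁∩p₂]─[q₁∩q₂]∣≤∣p₁─q₁∣+∣p₂─q₂∣ : ∀ {n} (p₁ p₂ q₁ q₂ : Subset n) →
  ∣ (p₁ ∪ p₂) ─ (q₁ ∪ q₂) ∣ + ∣ (p₁ ∩ p₂) ─ (q₁ ∩ q₂) ∣ ≤ ∣ p₁ ─ q₁ ∣ + ∣ p₂ ─ q₂ ∣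
∣[p₁∪p₂]─[q₁∪q₂]∣+∣[p₁∩p₂]─[q₁∩q₂]∣≤∣p₁─q₁∣+∣p₂─q₂∣ p₁ p₂ q₁ q₂ = ∣p∣+∣q∣≤∣r∣+∣s∣ ∪⊆ ∩⊆
  where
  P = (p₁ ∪ p₂) ─ (q₁ ∪ q₂)
  Q = (p₁ ∩ p₂) ─ (q₁ ∩ q₂)
  in₁ : ∀ {x} → x ∈ p₁ → x ∉ q₁ → x ∈ (p₁ ─ q₁) ∪ (p₂ ─ q₂)
  in₁ x∈p₁ x∉q₁ = p⊆p∪q _ (x∈p∧x∉q⇒x∈p─q x∈p₁ x∉q₁)
  in₂ : ∀ {x} → x ∈ p₂ → x ∉ q₂ → x ∈ (p₁ ─ q₁) ∪ (p₂ ─ q₂)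
  in₂ x∈p₂ x∉q₂ = q⊆p∪q (p₁ ─ q₁) _ (x∈p∧x∉q⇒x∈p─q x∈p₂ x∉q₂)
  from-P : ∀ {x} → x ∈ P → x ∈ (p₁ ─ q₁) ∪ (p₂ ─ q₂)
  from-P x∈P with x∈p─q⁻ (p₁ ∪ p₂) _ x∈P
  ... | x∈p₁∪p₂ , x∉q₁∪q₂ =
    [ (λ x∈p₁ → in₁ x∈p₁ (x∉q₁∪q₂ ∘ p⊆p∪q q₂)) , (λ x∈p₂ → in₂ x∈p₂ (x∉q₁∪q₂ ∘ q⊆p∪q q₁ q₂)) ]′
      (x∈p∪q⁻ p₁ p₂ x∈p₁∪p₂)
  from-Q : ∀ {x} → x ∈ Q → x ∈ (p₁ ─ q₁) ∪ (p₂ ─ q₂)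
  from-Q {x} x∈Q with x∈p─q⁻ (p₁ ∩ p₂) _ x∈Q | x ∈? q₁
  ... | x∈p₁∩p₂ , x∉q₁∩q₂ | yes x∈q₁ = in₂ (proj₂ (x∈p∩q⁻ p₁ p₂ x∈p₁∩p₂)) (λ x∈q₂ → x∉q₁∩q₂ (x∈p∩q⁺ (x∈q₁ , x∈q₂)))
  ... | x∈p₁∩p₂ , _ | no x∉q₁ = in₁ (proj₁ (x∈p∩q⁻ p₁ p₂ x∈p₁∩p₂)) x∉q₁
  ∪⊆ : P ∪ Q ⊆ (p₁ ─ q₁) ∪ (p₂ ─ q₂)
  ∪⊆ x∈ = [ from-P , from-Q ]′ (x∈p∪q⁻ P Q x∈)
  ∩⊆ : P ∩ Q ⊆ (p₁ ─ q₁) ∩ (p₂ ─ q₂)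
  ∩⊆ x∈ with x∈p∩q⁻ P Q x∈
  ... | x∈P , x∈Q with x∈p─q⁻ (p₁ ∪ p₂) _ x∈P | x∈p─q⁻ (p₁ ∩ p₂) _ x∈Q
  ... | _ , x∉q₁∪q₂ | x∈p₁∩p₂ , _ = let x∈p₁ , x∈p₂ = x∈p∩q⁻ p₁ p₂ x∈p₁∩p₂ in
    x∈p∩q⁺ (x∈p∧x∉q⇒x∈p─q x∈p₁ (x∉q₁∪q₂ ∘ p⊆p∪q q₂) , x∈p∧x∉q⇒x∈p─q x∈p₂ (x∉q₁∪q₂ ∘ q⊆p∪q q₁ q₂))

m+n∸o<n⇒m<o : ∀ m n o → (m + n) ∸ o < n → m < o
m+n∸o<n⇒m<o m n o lt = ≰⇒> λ o≤m → <⇒≱ lt (begin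
  n               ≤⟨ m≤n+m n (m ∸ o) ⟩
  (m ∸ o) + n     ≡⟨ +-∸-comm n o≤m ⟨
  (m + n) ∸ o     ∎)
  where open ≤-Reasoning

m+n∸o<m : ∀ {m n o} → o ≤ m + n → n < o → (m + n) ∸ o < m
m+n∸o<m {m} {n} {o} o≤m+n n<o = +-cancelʳ-≤ o _ _ (begin
  suc ((m + n) ∸ o) + o   ≡⟨ cong suc (m∸n+n≡m o≤m+n) ⟩
  suc (m + n)             ≡⟨ +-suc m n ⟨
  m + suc n               ≤⟨ +-monoʳ-≤ m n<o ⟩
  m + o                   ∎)
  where open ≤-Reasoning

m*n+m≡m*[1+n] : ∀ m n → m * n + m ≡ m * suc n
m*n+m≡m*[1+n] m n = trans (+-comm (m * n) m) (sym (*-suc m n))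

m+[n∸1+m]<n : ∀ {m n} → m < n → m + (n ∸ suc m) < n
m+[n∸1+m]<n m<n = ≤-reflexive (m+[n∸m]≡n m<n)

≤-slack : ∀ {p q w R} → p < R → q < R → p + q + w < R + R → w ≤ (R ∸ suc p) + ((R ∸ suc q) + 1)
≤-slack {p} {q} {w} {R} p<R q<R total< = s≤s⁻¹ (+-cancelˡ-≤ (p + q) _ _ (begin
  p + q + suc w                                   ≡⟨ +-suc (p + q) w ⟩
  suc (p + q + w)                                 ≤⟨ total< ⟩
  R + R                                           ≡⟨ cong₂ _+_ (m+[n∸m]≡n p<R) (m+[n∸m]≡n q<R) ⟨
  (suc p + (R ∸ suc p)) + (suc q + (R ∸ suc q))   ≡⟨ rearrange p q (R ∸ suc p) (R ∸ suc q) ⟩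
  p + q + suc ((R ∸ suc p) + ((R ∸ suc q) + 1))   ∎))
  where
  open ≤-Reasoning
  rearrange : ∀ p q a b → (1 + p + a) + (1 + q + b) ≡ p + q + (1 + (a + (b + 1)))
  rearrange = solve 4 (λ p q a b → (con 1 :+ p :+ a) :+ (con 1 :+ q :+ b)
                                  := p :+ q :+ (con 1 :+ (a :+ (b :+ con 1)))) refl

module _ {n : ℕ} (M : Matroid n) where

  r-⊥ : r M ⊥ ≡ 0
  r-⊥ = n≤0⇒n≡0 (≤-trans (r-bound M ⊥) (≤-reflexive (∣⊥∣≡0 n)))

  r-∪ : ∀ X Y → r M (X ∪ Y) ≤ r M X + r M Y
  r-∪ X Y = ≤-trans (m≤m+n _ _) (r-submod M X Y)

  r≤rankM : ∀ X → r M X ≤ rankM M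
  r≤rankM X = r-mono M ⊆⊤

  r-∪≤r+∣∣ : ∀ X Y → r M (X ∪ Y) ≤ r M X + ∣ Y ∣
  r-∪≤r+∣∣ X Y = ≤-trans (r-∪ X Y) (+-monoʳ-≤ (r M X) (r-bound M Y))

  r≤r+∣─∣ : ∀ X Z → r M X ≤ r M Z + ∣ X ─ Z ∣
  r≤r+∣─∣ X Z = begin
    r M X                   ≤⟨ r-mono M (p⊆[p─q]∪q X Z) ⟩
    r M ((X ─ Z) ∪ Z)       ≤⟨ r-∪ (X ─ Z) Z ⟩
    r M (X ─ Z) + r M Z     ≤⟨ +-monoˡ-≤ (r M Z) (r-bound M (X ─ Z)) ⟩
    ∣ X ─ Z ∣ + r M Z       ≡⟨ +-comm ∣ X ─ Z ∣ (r M Z) ⟩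
    r M Z + ∣ X ─ Z ∣       ∎
    where open ≤-Reasoning

  rankM≤r+r∁ : ∀ X → rankM M ≤ r M X + r M (∁ X)
  rankM≤r+r∁ X = ≤-trans (r-mono M (⊆-reflexive (sym (p∪∁p≡⊤ X)))) (r-∪ X (∁ X))

  r-augment-⊆ : ∀ {A B} e → A ⊆ B → r M B < r M (B ∪ ⁅ e ⁆) → r M A < r M (A ∪ ⁅ e ⁆)
  r-augment-⊆ {A} {B} e A⊆B B<B+e = +-cancelˡ-≤ (r M B) _ _ (begin
    r M B + suc (r M A)                           ≡⟨ +-suc (r M B) (r M A) ⟩
    suc (r M B) + r M A                           ≤⟨ +-monoˡ-≤ (r M A) B<B+e ⟩
    r M (B ∪ ⁅ e ⁆) + r M A                       ≤⟨ +-mono-≤ (r-mono M B+e⊆) (r-mono M A⊆) ⟩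
    r M (B ∪ (A ∪ ⁅ e ⁆)) + r M (B ∩ (A ∪ ⁅ e ⁆)) ≤⟨ r-submod M B (A ∪ ⁅ e ⁆) ⟩
    r M B + r M (A ∪ ⁅ e ⁆)                       ∎)
    where
    open ≤-Reasoning
    B+e⊆ : B ∪ ⁅ e ⁆ ⊆ B ∪ (A ∪ ⁅ e ⁆)
    B+e⊆ x∈ = [ p⊆p∪q _ , q⊆p∪q B _ ∘ q⊆p∪q A ⁅ e ⁆ ]′ (x∈p∪q⁻ B ⁅ e ⁆ x∈)
    A⊆ : A ⊆ B ∩ (A ∪ ⁅ e ⁆)
    A⊆ x∈A = x∈p∩q⁺ (A⊆B x∈A , p⊆p∪q ⁅ e ⁆ x∈A)

  Closure : Subset n → Set
  Closure A = ∃ λ F → IsFlat M F × A ⊆ F × r M F ≡ r M A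

  flatClosure : ∀ A → Closure A
  flatClosure = All.wfRec (On.wellFounded (∣_∣ ∘ ∁) <-wellFounded) _ Closure step
    where
    step : ∀ A → (∀ {B} → ∣ ∁ B ∣ < ∣ ∁ A ∣ → Closure B) → Closure A
    step A rec with any? (λ e → ¬? (e ∈? A) ×-dec (r M (A ∪ ⁅ e ⁆) ≤? r M A))
    ... | no noLoop = A , (λ e e∉A → ≰⇒> (λ le → noLoop (e , e∉A , le))) , id , refl
    ... | yes (e , e∉A , A+e≤A) =
      let F , flat , A+e⊆F , rF≡ = rec (p⊂q⇒∣p∣<∣q∣ ∁A+e⊂∁A)
      in F , flat , A+e⊆F ∘ p⊆p∪q ⁅ e ⁆ , trans rF≡ (≤-antisym A+e≤A (r-mono M (p⊆p∪q ⁅ e ⁆)))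
      where
      ∁A+e⊂∁A : ∁ (A ∪ ⁅ e ⁆) ⊂ ∁ A
      ∁A+e⊂∁A = p⊆q⇒∁p⊇∁q (p⊆p∪q ⁅ e ⁆) , e , x∉p⇒x∈∁p e∉A ,
                λ e∈∁ → x∈∁p⇒x∉p e∈∁ (q⊆p∪q A ⁅ e ⁆ (x∈⁅x⁆ e))

  flat-remove-coloop : ∀ {G e} → IsFlat M G → IsColoopOfRestriction M G e → IsFlat M (G - e)
  flat-remove-coloop {G} {e} flat (e∈G , G-e<G) f f∉G-e with f ≟ᶠ e
  ... | yes refl = <-≤-trans G-e<G (r-mono M (p⊆[p─q]∪q G ⁅ e ⁆))
  ... | no f≢e = r-augment-⊆ f (p─q⊆p G ⁅ e ⁆) (flat f (f∉G-e ∘ λ f∈G → x∈p∧x≢y⇒x∈p-y f∈G f≢e))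

  r+∣─∣-remove-coloop : ∀ {G e} X → IsColoopOfRestriction M G e →
                  r M (G - e) + ∣ X ─ (G - e) ∣ ≤ r M G + ∣ X ─ G ∣
  r+∣─∣-remove-coloop {G} {e} X (_ , G-e<G) = begin
    r M (G - e) + ∣ X ─ (G - e) ∣     ≤⟨ +-monoʳ-≤ (r M (G - e)) ∣X─[G-e]∣≤ ⟩
    r M (G - e) + suc ∣ X ─ G ∣       ≡⟨ +-suc (r M (G - e)) ∣ X ─ G ∣ ⟩
    suc (r M (G - e)) + ∣ X ─ G ∣     ≤⟨ +-monoˡ-≤ ∣ X ─ G ∣ G-e<G ⟩
    r M G + ∣ X ─ G ∣                 ∎
    where
    open ≤-Reasoning
    X─[G-e]⊆ : X ─ (G - e) ⊆ (X ─ G) ∪ ⁅ e ⁆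
    X─[G-e]⊆ {x} x∈ with x∈p─q⁻ X (G - e) x∈ | x ≟ᶠ e
    ... | _ | yes refl = q⊆p∪q (X ─ G) ⁅ e ⁆ (x∈⁅x⁆ e)
    ... | x∈X , x∉G-e | no x≢e = p⊆p∪q ⁅ e ⁆ (x∈p∧x∉q⇒x∈p─q x∈X (x∉G-e ∘ λ x∈G → x∈p∧x≢y⇒x∈p-y x∈G x≢e))
    ∣X─[G-e]∣≤ : ∣ X ─ (G - e) ∣ ≤ suc ∣ X ─ G ∣
    ∣X─[G-e]∣≤ = ≤-trans (p⊆q⇒∣p∣≤∣q∣ X─[G-e]⊆) (∣p∪⁅x⁆∣≤1+∣p∣ (X ─ G) e)

  cyclicFlat-r+∣─∣≤ : ∀ X G → IsFlat M G →
                      ∃ λ Z → IsCyclicFlat M Z × r M Z + ∣ X ─ Z ∣ ≤ r M G + ∣ X ─ G ∣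
  cyclicFlat-r+∣─∣≤ X = All.wfRec (On.wellFounded ∣_∣ <-wellFounded) _ P step
    where
    P : Subset n → Set
    P G = IsFlat M G → ∃ λ Z → IsCyclicFlat M Z × r M Z + ∣ X ─ Z ∣ ≤ r M G + ∣ X ─ G ∣
    step : ∀ G → (∀ {G′} → ∣ G′ ∣ < ∣ G ∣ → P G′) → P G
    step G rec flat with any? (λ e → (e ∈? G) ×-dec (r M (G - e) <? r M G))
    ... | no noColoop = G , (flat , λ e coloop → noColoop (e , coloop)) , ≤-refl
    ... | yes (e , coloop) =
      let Z , cyclicFlat , le = rec (x∈p⇒∣p-x∣<∣p∣ (proj₁ coloop)) (flat-remove-coloop flat coloop)
      in Z , cyclicFlat , ≤-trans le (r+∣─∣-remove-coloop X coloop)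

  rank-via-cyclicFlat : ∀ X → ∃ λ Z → IsCyclicFlat M Z × r M Z + ∣ X ─ Z ∣ ≤ r M X
  rank-via-cyclicFlat X =
    let F , flat , X⊆F , rF≡rX = flatClosure X
        Z , cyclicFlat , le = cyclicFlat-r+∣─∣≤ X F flat
    in Z , cyclicFlat ,
       ≤-trans le (≤-reflexive (trans (cong₂ _+_ rF≡rX (∣p─q∣≡0 X⊆F)) (+-identityʳ (r M X))))

  r<rankM-of-properFlat : ∀ {F} → IsProperFlat M F → r M F < rankM M
  r<rankM-of-properFlat (flat , F≢⊤) = let e , e∉F = ∃∉-of-≢⊤ F≢⊤ in <-≤-trans (flat e e∉F) (r≤rankM _)

  properFlat-⊇-of-r<rankM : ∀ {A} → r M A < rankM M → ∃ λ F → IsProperFlat M F × A ⊆ F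
  properFlat-⊇-of-r<rankM {A} A<rankM =
    let F , flat , A⊆F , rF≡rA = flatClosure A
    in F , (flat , λ F≡⊤ → <⇒≢ A<rankM (trans (sym rF≡rA) (cong (r M) F≡⊤))) , A⊆F

AlmostTwoFlatCover : ∀ {n} → Matroid n → Set
AlmostTwoFlatCover M = ∃₂ λ F₁ F₂ → IsProperFlat M F₁ × IsProperFlat M F₂ × ∣ ∁ (F₁ ∪ F₂) ∣ ≤ 1

module _ {n : ℕ} (M : Matroid n) where

  -- Spread the elements outside A₁ ∪ A₂ over the two sides, as many as each side can
  -- absorb without becoming spanning; at most one element is left over.
  almostTwoFlatCover : ∀ {A₁ A₂} → r M A₁ < rankM M → r M A₂ < rankM M →
                       r M A₁ + r M A₂ + ∣ ∁ (A₁ ∪ A₂) ∣ < rankM M + rankM M → AlmostTwoFlatCover M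
  almostTwoFlatCover {A₁} {A₂} A₁<R A₂<R total< =
    let B₁ , ∣B₁∣≤ , ∣W─B₁∣≤ = splitOff (∁ (A₁ ∪ A₂)) _ _ (≤-slack A₁<R A₂<R total<)
        B₂ , ∣B₂∣≤ , ∣W─B₁─B₂∣≤1 = splitOff (∁ (A₁ ∪ A₂) ─ B₁) _ 1 ∣W─B₁∣≤
        F₁ , proper₁ , A₁∪B₁⊆F₁ = properFlat-⊇-of-r<rankM M (nonspanning-∪ A₁<R ∣B₁∣≤)
        F₂ , proper₂ , A₂∪B₂⊆F₂ = properFlat-⊇-of-r<rankM M (nonspanning-∪ A₂<R ∣B₂∣≤)
    in F₁ , F₂ , proper₁ , proper₂ ,
       ≤-trans (p⊆q⇒∣p∣≤∣q∣ (∁[r₁∪r₂]⊆∁[p₁∪p₂]─q₁─q₂ A₁∪B₁⊆F₁ A₂∪B₂⊆F₂)) ∣W─B₁─B₂∣≤1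
    where
    nonspanning-∪ : ∀ {A B} → r M A < rankM M → ∣ B ∣ ≤ rankM M ∸ suc (r M A) → r M (A ∪ B) < rankM M
    nonspanning-∪ {A} {B} A<R ∣B∣≤ =
      ≤-<-trans (r-∪≤r+∣∣ M A B) (≤-<-trans (+-monoʳ-≤ (r M A) ∣B∣≤) (m+[n∸1+m]<n A<R))

  almostTwoFlatCover-separator : ∀ {F₁ F₂} → IsProperFlat M F₁ → ∣ ∁ (F₁ ∪ F₂) ∣ ≤ 1 →
                                 ∃ λ d → ∁ (F₁ ∪ F₂) ⊆ ⁅ d ⁆
  almostTwoFlatCover-separator (_ , F₁≢⊤) ∣miss∣≤1 = ⊆⁅⁆-of-∣∣≤1 _ ∣miss∣≤1 (proj₁ (∃∉-of-≢⊤ F₁≢⊤))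

  pointCover-of-almostTwoFlatCover : AlmostTwoFlatCover M →
    ∃₂ λ F₁ F₂ → ∃ λ (e : Fin n) → IsProperFlat M F₁ × IsProperFlat M F₂ × (F₁ ∪ F₂) ∪ ⁅ e ⁆ ≡ ⊤
  pointCover-of-almostTwoFlatCover (F₁ , F₂ , proper₁ , proper₂ , ∣miss∣≤1) =
    let d , miss⊆⁅d⁆ = almostTwoFlatCover-separator proper₁ ∣miss∣≤1
    in F₁ , F₂ , d , proper₁ , proper₂ , ⊆-antisym ⊆⊤ λ {x} _ → covered x miss⊆⁅d⁆
    where
    covered : ∀ x {d} → ∁ (F₁ ∪ F₂) ⊆ ⁅ d ⁆ → x ∈ (F₁ ∪ F₂) ∪ ⁅ d ⁆
    covered x miss⊆⁅d⁆ with x ∈? F₁ ∪ F₂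
    ... | yes x∈ = p⊆p∪q _ x∈
    ... | no x∉ = q⊆p∪q (F₁ ∪ F₂) _ (miss⊆⁅d⁆ (x∉p⇒x∈∁p x∉))

IsNonspanningPartition : ∀ {n} → Matroid n → Subset n → Set
IsNonspanningPartition M X = r M X < rankM M × r M (∁ X) < rankM M

module _ {n : ℕ} (M : Matroid n) where

  nonspanningPartition-of-vertSep : ∀ {k X} → IsVertSep M k X → IsNonspanningPartition M X
  nonspanningPartition-of-vertSep {X = X} (k≤X , k≤∁X , conn<k) =
    m+n∸o<n⇒m<o (r M X) (r M (∁ X)) (rankM M) (<-≤-trans conn<k k≤∁X) ,
    m+n∸o<n⇒m<o (r M (∁ X)) (r M X) (rankM M)
      (subst (λ s → s ∸ rankM M < r M X) (+-comm (r M X) (r M (∁ X))) (<-≤-trans conn<k k≤X))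

  vertSep-of-nonspanningPartition : ∀ {X} → IsNonspanningPartition M X → IsVertSep M (suc (conn M X)) X
  vertSep-of-nonspanningPartition {X} (X<rankM , ∁X<rankM) =
    m+n∸o<m (rankM≤r+r∁ M X) ∁X<rankM ,
    subst (λ s → s ∸ rankM M < r M (∁ X)) (+-comm (r M (∁ X)) (r M X))
      (m+n∸o<m (subst (rankM M ≤_) (+-comm (r M X) (r M (∁ X))) (rankM≤r+r∁ M X)) X<rankM) ,
    ≤-refl

  vertSep-≤-rankM : ∀ {k X} → IsVertSep M k X → k ≤ rankM M
  vertSep-≤-rankM (k≤X , _ , _) = ≤-trans k≤X (r≤rankM M _)

-- κ is defined through a private search function, so we reason about any function
-- satisfying its defining equations and let unification pick up the private one.
record IsSearch {n} (M : Matroid n) (S : ℕ → ℕ → ℕ → ℕ) : Set where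
  field
    S-zero : ∀ i d → S i zero d ≡ d
    S-suc  : ∀ i m d → S i (suc m) d ≡ (if does (hasVertSep? M i) then i else S (suc i) m d)

module _ {n : ℕ} {M : Matroid n} {S : ℕ → ℕ → ℕ → ℕ} (isSearch : IsSearch M S) where
  open IsSearch isSearch

  search-attained : ∀ i m d → S i m d ≡ d ⊎ HasVertSep M (S i m d)
  search-attained i zero d = inj₁ (S-zero i d)
  search-attained i (suc m) d rewrite S-suc i m d with hasVertSep? M i
  ... | yes h = inj₂ h
  ... | no _ = search-attained (suc i) m d

  search-least : ∀ i m d → (∀ {k} → k < i → ¬ HasVertSep M k) →
                 ∀ {k} → k < i + m → HasVertSep M k → S i m d ≤ k
  search-least i zero d below {k} k<i+0 h = ⊥-elim (below (subst (k <_) (+-identityʳ i) k<i+0) h)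
  search-least i (suc m) d below {k} k<i+1+m h rewrite S-suc i m d with hasVertSep? M i
  ... | yes _ = ≮⇒≥ (λ k<i → below k<i h)
  ... | no ¬hᵢ = search-least (suc i) m d below′ (subst (k <_) (+-suc i m) k<i+1+m) h
    where
    below′ : ∀ {k} → k < suc i → ¬ HasVertSep M k
    below′ k<1+i with m<1+n⇒m<n∨m≡n k<1+i
    ... | inj₁ k<i = below k<i
    ... | inj₂ refl = ¬hᵢ

-- A record, so that abstracting the rank in κ-spec does not reach into its fields.
record KappaSpec {n} (M : Matroid n) (v R : ℕ) : Set where
  field
    attained : v ≡ R ⊎ HasVertSep M v
    least    : ∀ {k} → HasVertSep M k → v ≤ k

mutual
  searchOf : ∀ {n} → Matroid n → ℕ → ℕ → ℕ → ℕ
  searchOf M = _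

  searchOf-isSearch : ∀ {n} (M : Matroid n) → IsSearch M (searchOf M)
  searchOf-isSearch M = record { S-zero = λ _ _ → refl ; S-suc = λ _ _ _ → refl }

  -- After two unfolding steps κ M is the private search applied to three distinct
  -- variables, so `searchOf M` is solved by pattern unification.
  κ-spec : ∀ {n} (M : Matroid n) → KappaSpec M (κ M) (rankM M)
  κ-spec M with hasVertSep? M 0
  ... | yes (_ , _ , _ , ())
  ... | no _ with r M ⊤ in rank≡
  ...   | zero = record { attained = inj₁ refl ; least = λ _ → z≤n }
  ...   | suc R with hasVertSep? M 1
  ...     | yes h₁ = record
    { attained = inj₂ h₁
    ; least    = λ { {zero} (_ , _ , _ , ()) ; {suc _} _ → s≤s z≤n }
    }
  ...     | no ¬h₁ with 2 in two≡ | suc R in d≡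
  ...       | i | d = record
    { attained = search-attained (searchOf-isSearch M) i R d
    ; least    = λ h → search-least (searchOf-isSearch M) i R d below (bounded h) h
    }
    where
    below : ∀ {k} → k < i → ¬ HasVertSep M k
    below {zero} _ (_ , _ , _ , ())
    below {suc zero} _ = ¬h₁
    below {suc (suc k)} k<i = ⊥-elim (<⇒≱ (subst (suc (suc k) <_) (sym two≡) k<i) (s≤s (s≤s z≤n)))
    bounded : ∀ {k} → HasVertSep M k → k < i + R
    bounded (_ , sep) = subst (λ j → _ < j + R) two≡
      (s≤s (≤-trans (vertSep-≤-rankM M sep) (≤-reflexive (trans rank≡ (sym d≡)))))

module _ {n : ℕ} (M : Matroid n) where
  open KappaSpec (κ-spec M)

  nonspanningPartition-of-κ<rankM : κ M < rankM M → ∃ (IsNonspanningPartition M)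
  nonspanningPartition-of-κ<rankM κ<rankM with attained
  ... | inj₁ κ≡rankM = ⊥-elim (<⇒≢ κ<rankM κ≡rankM)
  ... | inj₂ (X , sep) = X , nonspanningPartition-of-vertSep M sep

  κ<rankM-of-nonspanningPartition : ∀ {X} → IsNonspanningPartition M X → κ M < rankM M
  κ<rankM-of-nonspanningPartition {X} partition =
    let sep = vertSep-of-nonspanningPartition M partition
    in ≤-<-trans (least (X , sep)) (≤-<-trans (proj₁ sep) (proj₁ partition))

  κ≡rankM : ¬ ∃ (IsNonspanningPartition M) → κ M ≡ rankM M
  κ≡rankM noPartition with attained
  ... | inj₁ κ≡rankM = κ≡rankM
  ... | inj₂ (X , sep) = ⊥-elim (noPartition (X , nonspanningPartition-of-vertSep M sep))

module _ {n : ℕ} (t : ℕ) where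

  π : Fin (n * t) → Fin n
  π = quotient t

  ∈S⁺ : ∀ {A i} → π i ∈ A → i ∈ S[ t ] A
  ∈S⁺ {A} {i} πi∈A = lookup⇒[]= i _ (trans (lookup∘tabulate _ i) ([]=⇒lookup πi∈A))

  ∈S⁻ : ∀ {A i} → i ∈ S[ t ] A → π i ∈ A
  ∈S⁻ {A} {i} i∈SA = lookup⇒[]= (π i) A (trans (sym (lookup∘tabulate _ i)) ([]=⇒lookup i∈SA))

  S[]-mono : ∀ {A B} → A ⊆ B → S[ t ] A ⊆ S[ t ] B
  S[]-mono A⊆B = ∈S⁺ ∘ A⊆B ∘ ∈S⁻

  S[]-⊤ : S[ t ] (⊤ {n}) ≡ ⊤
  S[]-⊤ = ⊆-antisym ⊆⊤ (λ _ → ∈S⁺ ∈⊤)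

  S[]-zipWith : ∀ {f g : Bool → Bool → Bool} → (∀ x y → f x y ≡ g x y) →
                ∀ A B → S[ t ] (zipWith f A B) ≡ zipWith g (S[ t ] A) (S[ t ] B)
  S[]-zipWith {f} {g} f≗g A B = trans (tabulate-cong lookups) (tabulate∘lookup _)
    where
    lookups : ∀ i → lookup (zipWith f A B) (π i) ≡ lookup (zipWith g (S[ t ] A) (S[ t ] B)) i
    lookups i = begin
      lookup (zipWith f A B) (π i)                     ≡⟨ lookup-zipWith f (π i) A B ⟩
      f (lookup A (π i)) (lookup B (π i))              ≡⟨ f≗g _ _ ⟩
      g (lookup A (π i)) (lookup B (π i))              ≡⟨ cong₂ g (lookup∘tabulate _ i) (lookup∘tabulate _ i) ⟨
      g (lookup (S[ t ] A) i) (lookup (S[ t ] B) i)    ≡⟨ lookup-zipWith g i (S[ t ] A) (S[ t ] B) ⟨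
      lookup (zipWith g (S[ t ] A) (S[ t ] B)) i       ∎
      where open ≡-Reasoning

  S[]-∪ : ∀ A B → S[ t ] (A ∪ B) ≡ S[ t ] A ∪ S[ t ] B
  S[]-∪ = S[]-zipWith (λ _ _ → refl)

  S[]-∩ : ∀ A B → S[ t ] (A ∩ B) ≡ S[ t ] A ∩ S[ t ] B
  S[]-∩ = S[]-zipWith (λ _ _ → refl)

  S[]-─ : ∀ A B → S[ t ] (A ─ B) ≡ S[ t ] A ─ S[ t ] B
  S[]-─ A B = S[]-zipWith (λ { _ true → refl ; _ false → refl }) A B

  S[]-∁ : ∀ A → S[ t ] (∁ A) ≡ ∁ (S[ t ] A)
  S[]-∁ A = trans (tabulate-cong (λ i → lookup-map (π i) not A)) (tabulate-∘ not (λ i → lookup A (π i)))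

∣tabulate∣-+ : ∀ m k (f : Fin (m + k) → Bool) →
               ∣ tabulate f ∣ ≡ ∣ tabulate (f ∘ (_↑ˡ k)) ∣ + ∣ tabulate (f ∘ (m ↑ʳ_)) ∣
∣tabulate∣-+ zero k f = refl
∣tabulate∣-+ (suc m) k f with f zero
... | true = cong suc (∣tabulate∣-+ m k (f ∘ suc))
... | false = ∣tabulate∣-+ m k (f ∘ suc)

∣tabulate-const∣ : ∀ b t → ∣ tabulate {n = t} (λ _ → b) ∣ ≡ (if b then t else 0)
∣tabulate-const∣ true zero = refl
∣tabulate-const∣ true (suc t) = cong suc (∣tabulate-const∣ true t)
∣tabulate-const∣ false zero = refl
∣tabulate-const∣ false (suc t) = ∣tabulate-const∣ false t

π-↑ˡ : ∀ {n} t (i : Fin t) → π {suc n} t (i ↑ˡ n * t) ≡ zero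
π-↑ˡ {n} t i rewrite splitAt-↑ˡ t i (n * t) = refl

π-↑ʳ : ∀ {n} t (j : Fin (n * t)) → π {suc n} t (t ↑ʳ j) ≡ suc (π t j)
π-↑ʳ {n} t j rewrite splitAt-↑ʳ t (n * t) j = refl

∣S[]∣ : ∀ {n} t (A : Subset n) → ∣ S[ t ] A ∣ ≡ ∣ A ∣ * t
∣S[]∣ t [] = refl
∣S[]∣ {suc n} t (b ∷ A) = trans (∣tabulate∣-+ t (n * t) _) (trans (cong₂ _+_ fibre rest) (head b))
  where
  fibre : ∣ tabulate (λ i → lookup (b ∷ A) (π t (i ↑ˡ n * t))) ∣ ≡ (if b then t else 0)
  fibre = trans (cong ∣_∣ (tabulate-cong (cong (lookup (b ∷ A)) ∘ π-↑ˡ t))) (∣tabulate-const∣ b t)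
  rest : ∣ tabulate (λ j → lookup (b ∷ A) (π t (t ↑ʳ j))) ∣ ≡ ∣ A ∣ * t
  rest = trans (cong ∣_∣ (tabulate-cong (cong (lookup (b ∷ A)) ∘ π-↑ʳ t))) (∣S[]∣ t A)
  head : ∀ b → (if b then t else 0) + ∣ A ∣ * t ≡ ∣ b ∷ A ∣ * t
  head true = refl
  head false = refl

∣S[⁅e⁆]-i∣<t : ∀ {n} t (e : Fin n) {i} → i ∈ S[ t ] ⁅ e ⁆ → ∣ S[ t ] ⁅ e ⁆ - i ∣ < t
∣S[⁅e⁆]-i∣<t t e i∈S⁅e⁆ = <-≤-trans (x∈p⇒∣p-x∣<∣p∣ i∈S⁅e⁆)
  (≤-reflexive (trans (∣S[]∣ t ⁅ e ⁆) (trans (cong (_* t) (∣⁅x⁆∣≡1 e)) (*-identityˡ t))))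

representative : ∀ {n t} → 0 < t → Fin n → Fin (n * t)
representative 0<t e = combine e (fromℕ< 0<t)

π-representative : ∀ {n t} (0<t : 0 < t) (e : Fin n) → π t (representative 0<t e) ≡ e
π-representative {n} {t} 0<t e = cong proj₁ (remQuot-combine {n} {t} e (fromℕ< 0<t))

representative∈S : ∀ {n t A} {e : Fin n} (0<t : 0 < t) → e ∈ A → representative 0<t e ∈ S[ t ] A
representative∈S {e = e} 0<t e∈A = ∈S⁺ _ (subst (_∈ _) (sym (π-representative 0<t e)) e∈A)

minOver : ∀ {n} → (Subset n → ℕ) → ℕ
minOver {zero} f = f []
minOver {suc n} f = minOver (f ∘ (true ∷_)) ⊓ minOver (f ∘ (false ∷_))

minOver-≤ : ∀ {n} f (A : Subset n) → minOver f ≤ f A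
minOver-≤ f [] = ≤-refl
minOver-≤ f (true ∷ A) = ≤-trans (m⊓n≤m _ _) (minOver-≤ (f ∘ (true ∷_)) A)
minOver-≤ f (false ∷ A) = ≤-trans (m⊓n≤n _ _) (minOver-≤ (f ∘ (false ∷_)) A)

minOver-attained : ∀ {n} f → ∃ λ (A : Subset n) → minOver f ≡ f A
minOver-attained {zero} f = [] , refl
minOver-attained {suc n} f with ⊓-sel (minOver (f ∘ (true ∷_))) (minOver (f ∘ (false ∷_)))
... | inj₁ eq = let A , eqA = minOver-attained (f ∘ (true ∷_)) in true ∷ A , trans eq eqA
... | inj₂ eq = let A , eqA = minOver-attained (f ∘ (false ∷_)) in false ∷ A , trans eq eqA

minOver-greatest : ∀ {n k} f → (∀ (A : Subset n) → k ≤ f A) → k ≤ minOver f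
minOver-greatest f k≤f = let A , eq = minOver-attained f in subst (_ ≤_) (sym eq) (k≤f A)

module _ {n : ℕ} (t : ℕ) (M : Matroid n) where

  expansionCost : Subset (n * t) → Subset n → ℕ
  expansionCost Y A = t * r M A + ∣ Y ─ S[ t ] A ∣

  expansionRank : Subset (n * t) → ℕ
  expansionRank Y = minOver (expansionCost Y)

  t*r≤t*r+∣S[─]∣ : ∀ A B → t * r M A ≤ t * r M B + ∣ S[ t ] (A ─ B) ∣
  t*r≤t*r+∣S[─]∣ A B = begin
    t * r M A                        ≤⟨ *-monoʳ-≤ t (r≤r+∣─∣ M A B) ⟩
    t * (r M B + ∣ A ─ B ∣)          ≡⟨ *-distribˡ-+ t (r M B) ∣ A ─ B ∣ ⟩
    t * r M B + t * ∣ A ─ B ∣        ≡⟨ cong (t * r M B +_) (trans (*-comm t ∣ A ─ B ∣) (sym (∣S[]∣ t (A ─ B)))) ⟩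
    t * r M B + ∣ S[ t ] (A ─ B) ∣   ∎
    where open ≤-Reasoning

  expansionRank-S : ∀ A → expansionRank (S[ t ] A) ≡ t * r M A
  expansionRank-S A = ≤-antisym (≤-trans (minOver-≤ _ A) (≤-reflexive cost-A)) (minOver-greatest _ cost-B)
    where
    cost-A : expansionCost (S[ t ] A) A ≡ t * r M A
    cost-A = trans (cong (t * r M A +_) (∣p─q∣≡0 {p = S[ t ] A} ⊆-refl)) (+-identityʳ _)
    cost-B : ∀ B → t * r M A ≤ expansionCost (S[ t ] A) B
    cost-B B = ≤-trans (t*r≤t*r+∣S[─]∣ A B) (≤-reflexive (cong (λ V → t * r M B + ∣ V ∣) (S[]-─ t A B)))

  expansionCost-descent : ∀ Y {A Z} → r M Z + ∣ A ─ Z ∣ ≤ r M A → expansionCost Y Z ≤ expansionCost Y A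
  expansionCost-descent Y {A} {Z} Z-certifies-A = begin
    t * r M Z + ∣ Y ─ S[ t ] Z ∣                                   ≤⟨ +-monoʳ-≤ (t * r M Z) Y─SZ≤ ⟩
    t * r M Z + (∣ Y ─ S[ t ] A ∣ + ∣ S[ t ] A ─ S[ t ] Z ∣)       ≡⟨ cong (λ V → t * r M Z + (∣ Y ─ S[ t ] A ∣ + V)) ∣SA─SZ∣ ⟩
    t * r M Z + (∣ Y ─ S[ t ] A ∣ + ∣ A ─ Z ∣ * t)                 ≡⟨ rearrange t (r M Z) ∣ A ─ Z ∣ ∣ Y ─ S[ t ] A ∣ ⟩
    t * (r M Z + ∣ A ─ Z ∣) + ∣ Y ─ S[ t ] A ∣                     ≤⟨ +-monoˡ-≤ ∣ Y ─ S[ t ] A ∣ (*-monoʳ-≤ t Z-certifies-A) ⟩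
    t * r M A + ∣ Y ─ S[ t ] A ∣                                   ∎
    where
    open ≤-Reasoning
    Y─SZ≤ : ∣ Y ─ S[ t ] Z ∣ ≤ ∣ Y ─ S[ t ] A ∣ + ∣ S[ t ] A ─ S[ t ] Z ∣
    Y─SZ≤ = ≤-trans (p⊆q⇒∣p∣≤∣q∣ (p─r⊆[p─q]∪[q─r] Y (S[ t ] A) (S[ t ] Z))) (∣p∪q∣≤∣p∣+∣q∣ (Y ─ S[ t ] A) _)
    ∣SA─SZ∣ : ∣ S[ t ] A ─ S[ t ] Z ∣ ≡ ∣ A ─ Z ∣ * t
    ∣SA─SZ∣ = trans (cong ∣_∣ (sym (S[]-─ t A Z))) (∣S[]∣ t (A ─ Z))
    rearrange : ∀ t z d y → t * z + (y + d * t) ≡ t * (z + d) + y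
    rearrange = solve 4 (λ t z d y → t :* z :+ (y :+ d :* t) := t :* (z :+ d) :+ y) refl

  expansionRank-bound : ∀ Y → expansionRank Y ≤ ∣ Y ∣
  expansionRank-bound Y = begin
    expansionRank Y                      ≤⟨ minOver-≤ (expansionCost Y) ⊥ ⟩
    t * r M ⊥ + ∣ Y ─ S[ t ] (⊥ {n}) ∣   ≡⟨ cong (λ k → t * k + ∣ Y ─ S[ t ] (⊥ {n}) ∣) (r-⊥ M) ⟩
    t * 0 + ∣ Y ─ S[ t ] (⊥ {n}) ∣       ≡⟨ cong (_+ ∣ Y ─ S[ t ] (⊥ {n}) ∣) (*-zeroʳ t) ⟩
    ∣ Y ─ S[ t ] (⊥ {n}) ∣               ≤⟨ ∣p─q∣≤∣p∣ Y _ ⟩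
    ∣ Y ∣                                ∎
    where open ≤-Reasoning

  expansionRank-mono : ∀ {Y Y′} → Y ⊆ Y′ → expansionRank Y ≤ expansionRank Y′
  expansionRank-mono {Y} {Y′} Y⊆Y′ = minOver-greatest _ λ A → ≤-trans (minOver-≤ _ A)
    (+-monoʳ-≤ (t * r M A) (p⊆q⇒∣p∣≤∣q∣ (p─r⊆q─r (S[ t ] A) Y⊆Y′)))

  expansionRank-submod : ∀ Y₁ Y₂ → expansionRank (Y₁ ∪ Y₂) + expansionRank (Y₁ ∩ Y₂) ≤
                                   expansionRank Y₁ + expansionRank Y₂
  expansionRank-submod Y₁ Y₂ =
    let A₁ , eq₁ = minOver-attained (expansionCost Y₁)
        A₂ , eq₂ = minOver-attained (expansionCost Y₂)
    in begin
      expansionRank (Y₁ ∪ Y₂) + expansionRank (Y₁ ∩ Y₂)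
        ≤⟨ +-mono-≤ (minOver-≤ _ (A₁ ∪ A₂)) (minOver-≤ _ (A₁ ∩ A₂)) ⟩
      (t * r M (A₁ ∪ A₂) + ∣ (Y₁ ∪ Y₂) ─ S[ t ] (A₁ ∪ A₂) ∣) + (t * r M (A₁ ∩ A₂) + ∣ (Y₁ ∩ Y₂) ─ S[ t ] (A₁ ∩ A₂) ∣)
        ≡⟨ interchange (t * r M (A₁ ∪ A₂)) _ _ _ ⟩
      (t * r M (A₁ ∪ A₂) + t * r M (A₁ ∩ A₂)) + (∣ (Y₁ ∪ Y₂) ─ S[ t ] (A₁ ∪ A₂) ∣ + ∣ (Y₁ ∩ Y₂) ─ S[ t ] (A₁ ∩ A₂) ∣)
        ≤⟨ +-mono-≤ (scaled-submod A₁ A₂) (counted A₁ A₂) ⟩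
      (t * r M A₁ + t * r M A₂) + (∣ Y₁ ─ S[ t ] A₁ ∣ + ∣ Y₂ ─ S[ t ] A₂ ∣)
        ≡⟨ interchange (t * r M A₁) _ _ _ ⟩
      expansionCost Y₁ A₁ + expansionCost Y₂ A₂
        ≡⟨ cong₂ _+_ eq₁ eq₂ ⟨
      expansionRank Y₁ + expansionRank Y₂ ∎
    where
    open ≤-Reasoning
    scaled-submod : ∀ A₁ A₂ → t * r M (A₁ ∪ A₂) + t * r M (A₁ ∩ A₂) ≤ t * r M A₁ + t * r M A₂
    scaled-submod A₁ A₂ = begin
      t * r M (A₁ ∪ A₂) + t * r M (A₁ ∩ A₂)   ≡⟨ *-distribˡ-+ t _ _ ⟨
      t * (r M (A₁ ∪ A₂) + r M (A₁ ∩ A₂))     ≤⟨ *-monoʳ-≤ t (r-submod M A₁ A₂) ⟩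
      t * (r M A₁ + r M A₂)                   ≡⟨ *-distribˡ-+ t _ _ ⟩
      t * r M A₁ + t * r M A₂                 ∎
    counted : ∀ A₁ A₂ → ∣ (Y₁ ∪ Y₂) ─ S[ t ] (A₁ ∪ A₂) ∣ + ∣ (Y₁ ∩ Y₂) ─ S[ t ] (A₁ ∩ A₂) ∣ ≤
                        ∣ Y₁ ─ S[ t ] A₁ ∣ + ∣ Y₂ ─ S[ t ] A₂ ∣
    counted A₁ A₂ = subst₂ (λ U V → ∣ (Y₁ ∪ Y₂) ─ U ∣ + ∣ (Y₁ ∩ Y₂) ─ V ∣ ≤ ∣ Y₁ ─ S[ t ] A₁ ∣ + ∣ Y₂ ─ S[ t ] A₂ ∣)
      (sym (S[]-∪ t A₁ A₂)) (sym (S[]-∩ t A₁ A₂))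
      (∣[p₁∪p₂]─[q₁∪q₂]∣+∣[p₁∩p₂]─[q₁∩q₂]∣≤∣p₁─q₁∣+∣p₂─q₂∣ Y₁ Y₂ (S[ t ] A₁) (S[ t ] A₂))

  expansion : Matroid (n * t)
  expansion = record
    { r        = expansionRank
    ; r-bound  = expansionRank-bound
    ; r-mono   = expansionRank-mono
    ; r-submod = expansionRank-submod
    }

module _ {n : ℕ} (t : ℕ) (M : Matroid n) (N : Matroid (n * t)) (isExpansion : IsExpansion t M N) where
  private
    cyclicFlat-fibred : ∀ Y → IsCyclicFlat N Y → ∃ λ A → IsCyclicFlat M A × Y ≡ S[ t ] A
    cyclicFlat-fibred = proj₁ isExpansion
    r-S : ∀ A → IsCyclicFlat M A → r N (S[ t ] A) ≡ t * r M A
    r-S = proj₂ (proj₂ isExpansion)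

  r-expansion : ∀ Y → r N Y ≡ expansionRank t M Y
  r-expansion Y = ≤-antisym (minOver-greatest _ upper) lower
    where
    upper : ∀ A → r N Y ≤ expansionCost t M Y A
    upper A =
      let Z , cyclicFlat , Z-certifies-A = rank-via-cyclicFlat M A
      in begin
        r N Y                              ≤⟨ r≤r+∣─∣ N Y (S[ t ] Z) ⟩
        r N (S[ t ] Z) + ∣ Y ─ S[ t ] Z ∣  ≡⟨ cong (_+ ∣ Y ─ S[ t ] Z ∣) (r-S Z cyclicFlat) ⟩
        expansionCost t M Y Z              ≤⟨ expansionCost-descent t M Y Z-certifies-A ⟩
        expansionCost t M Y A              ∎
      where open ≤-Reasoning
    lower : expansionRank t M Y ≤ r N Y
    lower with rank-via-cyclicFlat N Y
    ... | Z , cyclicFlat , Z-certifies-Y with cyclicFlat-fibred Z cyclicFlat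
    ... | A , cyclicFlatA , refl = begin
      expansionRank t M Y                ≤⟨ minOver-≤ _ A ⟩
      expansionCost t M Y A              ≡⟨ cong (_+ ∣ Y ─ S[ t ] A ∣) (r-S A cyclicFlatA) ⟨
      r N (S[ t ] A) + ∣ Y ─ S[ t ] A ∣  ≤⟨ Z-certifies-Y ⟩
      r N Y                              ∎
      where open ≤-Reasoning

  rankM-expansion : rankM N ≡ t * rankM M
  rankM-expansion =
    trans (r-expansion ⊤) (trans (cong (expansionRank t M) (sym (S[]-⊤ {n} t))) (expansionRank-S t M ⊤))

module _ {n : ℕ} (t : ℕ) (M : Matroid n) where

  almostTwoFlatCover-of-expansionRank< : ∀ X → expansionRank t M X < t * rankM M →
    expansionRank t M (∁ X) < t * rankM M → AlmostTwoFlatCover M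
  almostTwoFlatCover-of-expansionRank< X X< ∁X< =
    almostTwoFlatCover M (cancel (≤-<-trans (m≤m+n _ _) cost₁<)) (cancel (≤-<-trans (m≤m+n _ _) cost₂<))
                         (cancel total<)
    where
    R = rankM M
    A₁ = proj₁ (minOver-attained (expansionCost t M X))
    A₂ = proj₁ (minOver-attained (expansionCost t M (∁ X)))
    x₁ = ∣ X ─ S[ t ] A₁ ∣
    x₂ = ∣ ∁ X ─ S[ t ] A₂ ∣
    w = ∣ ∁ (A₁ ∪ A₂) ∣
    cancel : ∀ {a b} → t * a < t * b → a < b
    cancel = *-cancelˡ-< t _ _
    cost₁< : t * r M A₁ + x₁ < t * R
    cost₁< = subst (_< t * R) (proj₂ (minOver-attained (expansionCost t M X))) X<
    cost₂< : t * r M A₂ + x₂ < t * R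
    cost₂< = subst (_< t * R) (proj₂ (minOver-attained (expansionCost t M (∁ X)))) ∁X<
    w*t≤ : w * t ≤ x₁ + x₂
    w*t≤ = begin
      w * t                                     ≡⟨ ∣S[]∣ t (∁ (A₁ ∪ A₂)) ⟨
      ∣ S[ t ] (∁ (A₁ ∪ A₂)) ∣                  ≡⟨ cong ∣_∣ (trans (S[]-∁ t (A₁ ∪ A₂)) (cong ∁ (S[]-∪ t A₁ A₂))) ⟩
      ∣ ∁ (S[ t ] A₁ ∪ S[ t ] A₂) ∣             ≤⟨ p⊆q⇒∣p∣≤∣q∣ (∁[p∪q]⊆[r─p]∪[∁r─q] (S[ t ] A₁) (S[ t ] A₂) X) ⟩
      ∣ (X ─ S[ t ] A₁) ∪ (∁ X ─ S[ t ] A₂) ∣   ≤⟨ ∣p∪q∣≤∣p∣+∣q∣ (X ─ S[ t ] A₁) _ ⟩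
      x₁ + x₂                                   ∎
      where open ≤-Reasoning
    total< : t * (r M A₁ + r M A₂ + w) < t * (R + R)
    total< = begin-strict
      t * (r M A₁ + r M A₂ + w)                   ≡⟨ distribute t (r M A₁) (r M A₂) w ⟩
      (t * r M A₁ + t * r M A₂) + w * t           ≤⟨ +-monoʳ-≤ (t * r M A₁ + t * r M A₂) w*t≤ ⟩
      (t * r M A₁ + t * r M A₂) + (x₁ + x₂)       ≡⟨ interchange (t * r M A₁) (t * r M A₂) x₁ x₂ ⟩
      (t * r M A₁ + x₁) + (t * r M A₂ + x₂)       <⟨ +-mono-< cost₁< cost₂< ⟩
      t * R + t * R                               ≡⟨ *-distribˡ-+ t R R ⟨
      t * (R + R)                                 ∎
      where
      open ≤-Reasoning
      distribute : ∀ t a b w → t * (a + b + w) ≡ (t * a + t * b) + w * t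
      distribute = solve 4 (λ t a b w → t :* (a :+ b :+ w) := (t :* a :+ t :* b) :+ w :* t) refl

  expansionRank<t*rankM : ∀ {F Y} → IsProperFlat M F → ∣ Y ─ S[ t ] F ∣ < t →
                          expansionRank t M Y < t * rankM M
  expansionRank<t*rankM {F} {Y} proper ∣Y─SF∣<t = begin-strict
    expansionRank t M Y             ≤⟨ minOver-≤ _ F ⟩
    t * r M F + ∣ Y ─ S[ t ] F ∣    <⟨ +-monoʳ-< (t * r M F) ∣Y─SF∣<t ⟩
    t * r M F + t                   ≡⟨ m*n+m≡m*[1+n] t (r M F) ⟩
    t * suc (r M F)                 ≤⟨ *-monoʳ-≤ t (r<rankM-of-properFlat M proper) ⟩
    t * rankM M                     ∎
    where open ≤-Reasoning

  -- Each side misses fewer than t elements of S_{F₁}, resp. S_{F₂}: the first side misses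
  -- S_d − j, the second only j, and 1 < t.
  expansionRank<-of-almostTwoFlatCover : 1 < t → AlmostTwoFlatCover M →
    ∃ λ X → expansionRank t M X < t * rankM M × expansionRank t M (∁ X) < t * rankM M
  expansionRank<-of-almostTwoFlatCover 1<t (F₁ , F₂ , proper₁ , proper₂ , ∣miss∣≤1) =
    X , expansionRank<t*rankM {Y = X} proper₁ ∣X─SF₁∣<t , expansionRank<t*rankM {Y = ∁ X} proper₂ ∣∁X─SF₂∣<t
    where
    d = proj₁ (almostTwoFlatCover-separator M proper₁ ∣miss∣≤1)
    0<t = <-trans z<s 1<t
    j = representative 0<t d
    X = S[ t ] F₁ ∪ (S[ t ] ⁅ d ⁆ - j)
    ∣X─SF₁∣<t : ∣ X ─ S[ t ] F₁ ∣ < t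
    ∣X─SF₁∣<t = ≤-<-trans (p⊆q⇒∣p∣≤∣q∣ ([p∪q]─p⊆q (S[ t ] F₁) _))
                          (∣S[⁅e⁆]-i∣<t t d (representative∈S 0<t (x∈⁅x⁆ d)))
    ∁[SF₁∪SF₂]⊆S⁅d⁆ : ∁ (S[ t ] F₁ ∪ S[ t ] F₂) ⊆ S[ t ] ⁅ d ⁆
    ∁[SF₁∪SF₂]⊆S⁅d⁆ = subst (_⊆ S[ t ] ⁅ d ⁆) (trans (S[]-∁ t (F₁ ∪ F₂)) (cong ∁ (S[]-∪ t F₁ F₂)))
                            (S[]-mono t (proj₂ (almostTwoFlatCover-separator M proper₁ ∣miss∣≤1)))
    ∣∁X─SF₂∣<t : ∣ ∁ X ─ S[ t ] F₂ ∣ < t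
    ∣∁X─SF₂∣<t = ≤-<-trans (p⊆q⇒∣p∣≤∣q∣ (∁[p∪[s-x]]─q⊆⁅x⁆ j ∁[SF₁∪SF₂]⊆S⁅d⁆))
                           (subst (_< t) (sym (∣⁅x⁆∣≡1 j)) 1<t)

module _ {n t : ℕ} (M : Matroid n) (N : Matroid (n * t)) (r-S : ∀ A → r N (S[ t ] A) ≡ t * r M A) where

  -- S_{A ∪ e} adds to S_A ∪ {i} only the t − 1 other elements of S_e, too few to
  -- absorb the rank increase t.
  S-flat⁺ : ∀ {A} → IsFlat M A → IsFlat N (S[ t ] A)
  S-flat⁺ {A} flat i i∉SA = +-cancelʳ-< t _ _ (begin-strict
    r N (S[ t ] A) + t                                 ≡⟨ cong (_+ t) (r-S A) ⟩
    t * r M A + t                                      ≡⟨ m*n+m≡m*[1+n] t (r M A) ⟩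
    t * suc (r M A)                                    ≤⟨ *-monoʳ-≤ t (flat e (i∉SA ∘ ∈S⁺ t)) ⟩
    t * r M (A ∪ ⁅ e ⁆)                                ≡⟨ r-S (A ∪ ⁅ e ⁆) ⟨
    r N (S[ t ] (A ∪ ⁅ e ⁆))                           ≤⟨ r≤r+∣─∣ N _ (S[ t ] A ∪ ⁅ i ⁆) ⟩
    r N (S[ t ] A ∪ ⁅ i ⁆) + ∣ S[ t ] (A ∪ ⁅ e ⁆) ─ (S[ t ] A ∪ ⁅ i ⁆) ∣
                                                       <⟨ +-monoʳ-< (r N (S[ t ] A ∪ ⁅ i ⁆)) fibreRest<t ⟩
    r N (S[ t ] A ∪ ⁅ i ⁆) + t                         ∎)
    where
    open ≤-Reasoning
    e = π t i
    fibreRest<t : ∣ S[ t ] (A ∪ ⁅ e ⁆) ─ (S[ t ] A ∪ ⁅ i ⁆) ∣ < t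
    fibreRest<t = ≤-<-trans
      (p⊆q⇒∣p∣≤∣q∣ (subst (λ V → V ─ (S[ t ] A ∪ ⁅ i ⁆) ⊆ S[ t ] ⁅ e ⁆ - i) (sym (S[]-∪ t A ⁅ e ⁆))
        ([p∪q]─[p∪⁅x⁆]⊆q-x (S[ t ] A) (S[ t ] ⁅ e ⁆) i)))
      (∣S[⁅e⁆]-i∣<t t e (∈S⁺ t (x∈⁅x⁆ e)))

  S-coloopFree⁺ : ∀ {A} → (∀ e → ¬ IsColoopOfRestriction M A e) →
                  ∀ i → ¬ IsColoopOfRestriction N (S[ t ] A) i
  S-coloopFree⁺ {A} coloopFree i (i∈SA , SA-i<SA) = <⇒≱ SA-i<SA (begin
    r N (S[ t ] A)                ≡⟨ r-S A ⟩
    t * r M A                     ≤⟨ *-monoʳ-≤ t (≮⇒≥ λ A-e<A → coloopFree e (∈S⁻ t i∈SA , A-e<A)) ⟩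
    t * r M (A - e)               ≡⟨ r-S (A - e) ⟨
    r N (S[ t ] (A - e))          ≤⟨ r-mono N S[A-e]⊆SA-i ⟩
    r N (S[ t ] A - i)            ∎)
    where
    open ≤-Reasoning
    e = π t i
    S[A-e]⊆SA-i : S[ t ] (A - e) ⊆ S[ t ] A - i
    S[A-e]⊆SA-i = subst (_⊆ S[ t ] A - i) (sym (S[]-─ t A ⁅ e ⁆)) (p─q⊆p-x (S[ t ] A) _ (∈S⁺ t (x∈⁅x⁆ e)))

  module _ (0<t : 0 < t) where

    S-flat⁻ : ∀ {A} → IsFlat N (S[ t ] A) → IsFlat M A
    S-flat⁻ {A} flat e e∉A = *-cancelˡ-< t _ _ (begin-strict
      t * r M A                     ≡⟨ r-S A ⟨
      r N (S[ t ] A)                <⟨ flat i (e∉A ∘ subst (_∈ A) (π-representative 0<t e) ∘ ∈S⁻ t) ⟩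
      r N (S[ t ] A ∪ ⁅ i ⁆)        ≤⟨ r-mono N SA+i⊆ ⟩
      r N (S[ t ] (A ∪ ⁅ e ⁆))      ≡⟨ r-S (A ∪ ⁅ e ⁆) ⟩
      t * r M (A ∪ ⁅ e ⁆)           ∎)
      where
      open ≤-Reasoning
      i = representative 0<t e
      SA+i⊆ : S[ t ] A ∪ ⁅ i ⁆ ⊆ S[ t ] (A ∪ ⁅ e ⁆)
      SA+i⊆ = subst (S[ t ] A ∪ ⁅ i ⁆ ⊆_) (sym (S[]-∪ t A ⁅ e ⁆))
                (p∪⁅x⁆⊆p∪q (S[ t ] A) _ (representative∈S 0<t (x∈⁅x⁆ e)))

    S-coloopFree⁻ : ∀ {A} → (∀ i → ¬ IsColoopOfRestriction N (S[ t ] A) i) →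
                    ∀ e → ¬ IsColoopOfRestriction M A e
    S-coloopFree⁻ {A} coloopFree e (e∈A , A-e<A) = <-irrefl refl (begin-strict
      r N (S[ t ] A)                                     ≤⟨ ≮⇒≥ (coloopFree i ∘ (representative∈S 0<t e∈A ,_)) ⟩
      r N (S[ t ] A - i)                                 ≤⟨ r≤r+∣─∣ N _ (S[ t ] (A - e)) ⟩
      r N (S[ t ] (A - e)) + ∣ (S[ t ] A - i) ─ S[ t ] (A - e) ∣
                                                         <⟨ +-monoʳ-< (r N (S[ t ] (A - e))) fibreRest<t ⟩
      r N (S[ t ] (A - e)) + t                           ≡⟨ cong (_+ t) (r-S (A - e)) ⟩
      t * r M (A - e) + t                                ≡⟨ m*n+m≡m*[1+n] t (r M (A - e)) ⟩
      t * suc (r M (A - e))                              ≤⟨ *-monoʳ-≤ t A-e<A ⟩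
      t * r M A                                          ≡⟨ r-S A ⟨
      r N (S[ t ] A)                                     ∎)
      where
      open ≤-Reasoning
      i = representative 0<t e
      fibreRest<t : ∣ (S[ t ] A - i) ─ S[ t ] (A - e) ∣ < t
      fibreRest<t = ≤-<-trans
        (p⊆q⇒∣p∣≤∣q∣ (subst (λ V → (S[ t ] A - i) ─ V ⊆ S[ t ] ⁅ e ⁆ - i) (sym (S[]-─ t A ⁅ e ⁆))
          ([p-x]─[p─q]⊆q-x (S[ t ] A) (S[ t ] ⁅ e ⁆) i)))
        (∣S[⁅e⁆]-i∣<t t e (representative∈S 0<t (x∈⁅x⁆ e)))

    S-cyclicFlat⁻ : ∀ {A} → IsCyclicFlat N (S[ t ] A) → IsCyclicFlat M A
    S-cyclicFlat⁻ (flat , coloopFree) = S-flat⁻ flat , S-coloopFree⁻ coloopFree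

  S-cyclicFlat⁺ : ∀ {A} → IsCyclicFlat M A → IsCyclicFlat N (S[ t ] A)
  S-cyclicFlat⁺ (flat , coloopFree) = S-flat⁺ flat , S-coloopFree⁺ coloopFree

module _ {n : ℕ} (t : ℕ) (M : Matroid n) where

  cyclicFlat-expansion-fibred : ∀ Y → IsCyclicFlat (expansion t M) Y → ∃ λ A → Y ≡ S[ t ] A
  cyclicFlat-expansion-fibred Y (flat , coloopFree) = A , ⊆-antisym Y⊆SA SA⊆Y
    where
    open ≤-Reasoning
    A = proj₁ (minOver-attained (expansionCost t M Y))
    rY≡ : expansionRank t M Y ≡ expansionCost t M Y A
    rY≡ = proj₂ (minOver-attained (expansionCost t M Y))
    Y⊆SA : Y ⊆ S[ t ] A
    Y⊆SA {i} i∈Y = decidable-stable (i ∈? S[ t ] A) λ i∉SA → coloopFree i (i∈Y , Y-i<Y i∉SA)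
      where
      Y-i<Y : i ∉ S[ t ] A → expansionRank t M (Y - i) < expansionRank t M Y
      Y-i<Y i∉SA = let i∈Y─SA = x∈p∧x∉q⇒x∈p─q i∈Y i∉SA in begin-strict
        expansionRank t M (Y - i)            ≤⟨ minOver-≤ (expansionCost t M (Y - i)) A ⟩
        t * r M A + ∣ (Y - i) ─ S[ t ] A ∣   <⟨ +-monoʳ-< (t * r M A) (∣[p-x]─q∣<∣p─q∣ Y (S[ t ] A) i∈Y─SA) ⟩
        t * r M A + ∣ Y ─ S[ t ] A ∣         ≡⟨ rY≡ ⟨
        expansionRank t M Y                  ∎
    rY≡t*rA : expansionRank t M Y ≡ t * r M A
    rY≡t*rA = trans rY≡ (trans (cong (t * r M A +_) (∣p─q∣≡0 Y⊆SA)) (+-identityʳ _))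
    SA⊆Y : S[ t ] A ⊆ Y
    SA⊆Y {i} i∈SA = decidable-stable (i ∈? Y) λ i∉Y → <-irrefl refl (begin-strict
      expansionRank t M Y                <⟨ flat i i∉Y ⟩
      expansionRank t M (Y ∪ ⁅ i ⁆)      ≤⟨ expansionRank-mono t M Y+i⊆SA ⟩
      expansionRank t M (S[ t ] A)       ≡⟨ expansionRank-S t M A ⟩
      t * r M A                          ≡⟨ rY≡t*rA ⟨
      expansionRank t M Y                ∎)
      where
      Y+i⊆SA : Y ∪ ⁅ i ⁆ ⊆ S[ t ] A
      Y+i⊆SA = [ Y⊆SA , (λ j∈⁅i⁆ → subst (_∈ S[ t ] A) (sym (x∈⁅y⁆⇒x≡y i j∈⁅i⁆)) i∈SA) ]′ ∘ x∈p∪q⁻ Y ⁅ i ⁆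

  expansion-isExpansion : 0 < t → IsExpansion t M (expansion t M)
  expansion-isExpansion 0<t =
    (λ Y cyclicFlat → let A , Y≡SA = cyclicFlat-expansion-fibred Y cyclicFlat in
      A , S-cyclicFlat⁻ M (expansion t M) (expansionRank-S t M) 0<t
            (subst (IsCyclicFlat (expansion t M)) Y≡SA cyclicFlat) , Y≡SA) ,
    (λ A → S-cyclicFlat⁺ M (expansion t M) (expansionRank-S t M)) ,
    (λ A _ → expansionRank-S t M A)

module _ {n : ℕ} (t : ℕ) (M : Matroid n) (N : Matroid (n * t)) (isExpansion : IsExpansion t M N) where

  expansionRank<-of-nonspanning : ∀ X → r N X < rankM N → expansionRank t M X < t * rankM M
  expansionRank<-of-nonspanning X = subst₂ _<_ (r-expansion t M N isExpansion X) (rankM-expansion t M N isExpansion)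

  nonspanning-of-expansionRank< : ∀ X → expansionRank t M X < t * rankM M → r N X < rankM N
  nonspanning-of-expansionRank< X =
    subst₂ _<_ (sym (r-expansion t M N isExpansion X)) (sym (rankM-expansion t M N isExpansion))

  almostTwoFlatCover-of-κ<rankM : κ N < rankM N → AlmostTwoFlatCover M
  almostTwoFlatCover-of-κ<rankM κ<rankM =
    let X , X<rankM , ∁X<rankM = nonspanningPartition-of-κ<rankM N κ<rankM
    in almostTwoFlatCover-of-expansionRank< t M X (expansionRank<-of-nonspanning X X<rankM)
                                                  (expansionRank<-of-nonspanning (∁ X) ∁X<rankM)

  κ<rankM-of-almostTwoFlatCover : 1 < t → AlmostTwoFlatCover M → κ N < rankM N
  κ<rankM-of-almostTwoFlatCover 1<t cover =
    let X , X< , ∁X< = expansionRank<-of-almostTwoFlatCover t M 1<t cover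
    in κ<rankM-of-nonspanningPartition N (nonspanning-of-expansionRank< X X< , nonspanning-of-expansionRank< (∁ X) ∁X<)

theorem5p3 : ∀ {n} (M : Matroid n) →
    let
      cond1 = ∃₂ λ F₁ F₂ → IsProperFlat M F₁ × IsProperFlat M F₂ × ∣ ∁ (F₁ ∪ F₂) ∣ ≤ 1
      cond2 = ∀ (t : ℕ) → t ≥ 2 → ∀ (N : Matroid (n * t)) → IsExpansion t M N → κ N < rankM N
      cond3 = ∃ λ (t : ℕ) → t ≥ 2 × ∃ λ (N : Matroid (n * t)) → IsExpansion t M N × κ N < rankM N
    in
    (cond1 → cond2) × (cond2 → cond3) × (cond3 → cond1)
    × (¬ (∃₂ λ F₁ F₂ → ∃ λ (e : Fin n) → IsProperFlat M F₁ × IsProperFlat M F₂ × (F₁ ∪ F₂) ∪ ⁅ e ⁆ ≡ ⊤)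
       → ∀ (t : ℕ) → t ≥ 1 → ∀ (N : Matroid (n * t)) → IsExpansion t M N → κ N ≡ rankM N)
theorem5p3 M =
  (λ cover t 2≤t N isExpansion → κ<rankM-of-almostTwoFlatCover t M N isExpansion 2≤t cover) ,
  (λ κ<rankM-for-all → 2 , ≤-refl , expansion 2 M , expansion-isExpansion 2 M z<s ,
     κ<rankM-for-all 2 ≤-refl (expansion 2 M) (expansion-isExpansion 2 M z<s)) ,
  (λ (t , _ , N , isExpansion , κ<rankM) → almostTwoFlatCover-of-κ<rankM t M N isExpansion κ<rankM) ,
  λ noPointCover t _ N isExpansion → κ≡rankM N λ (_ , partition) →
    noPointCover (pointCover-of-almostTwoFlatCover M
      (almostTwoFlatCover-of-κ<rankM t M N isExpansion (κ<rankM-of-nonspanningPartition N partition)))
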